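{- Let $t$ be a positive integer, let $G$ be a finite simple graph with a weight function $w:E(G)\rightarrow \mathbb{Q}^+$, and let $\varepsilon\in(0,1)$ be rational. Let $w_1$ be the smallest value of $w$ on $E(G)$. Let $w'$ be a weight function on $E(G)$ that coincides with $w$ except that every edge $e$ with $w(e)=w_1$ receives the weight $w'(e)=w'_1$, where \[w_1\leq w'_1\leq \left(1+\frac{\varepsilon}{t}\right)\cdot w_1.\] Let $OPT$ and $OPT'$ denote the maximum weight of a matching of $G$ with respect to $w$ and $w'$, respectively, and let $\theta=\frac{t-1}{t}\cdot\varepsilon$. If $M$ is a matching of $G$ with $w'(M)\geq (1-\theta)\cdot OPT'$, then $w(M)\geq (1-\varepsilon)\cdot OPT$.
   Context: A matching in a graph is a set of edges no two of which share a vertex. For a weight function $w$ and a set of edges $M$, $w(M)=\sum_{e\in M}w(e)$. $\mathbb{Q}^+$ denotes the positive rationals. -}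

module Defs where

open import Data.Nat using (ℕ)
open import Data.Fin using (Fin; _<_)
open import Data.Bool using (Bool; true; false; if_then_else_)
open import Data.List using (List; map; foldr; concatMap)
open import Data.Vec.Functional using ()
open import Data.Fin using (toℕ)
open import Data.List using (allFin)
open import Data.Rational using (ℚ; 0ℚ; _+_; Positive)
open import Relation.Binary.PropositionalEquality using (_≡_; _≢_)
open import Data.Product using (_×_; Σ; ∃; _,_)

-- A finite simple graph on vertex set Fin n, given by a symmetric,
-- irreflexive adjacency relation. An edge {i,j} is represented by the
-- ordered pair (i, j) with i < j and adj i j ≡ true.
record SimpleGraph (n : ℕ) : Set where
  field
    adj   : Fin n → Fin n → Bool
    sym   : ∀ i j → adj i j ≡ adj j i
    irrefl : ∀ i → adj i i ≡ false
open SimpleGraph public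

IsEdge : ∀ {n} → SimpleGraph n → Fin n → Fin n → Set
IsEdge G i j = (i < j) × (adj G i j ≡ true)

-- A weight function on edges: values matter only on edges (i<j orientation).
Weight : ℕ → Set
Weight n = Fin n → Fin n → ℚ

PositiveWeight : ∀ {n} → SimpleGraph n → Weight n → Set
PositiveWeight G w = ∀ i j → IsEdge G i j → Positive (w i j)

EdgeSet : ℕ → Set
EdgeSet n = Fin n → Fin n → Bool

IsMatching : ∀ {n} → SimpleGraph n → EdgeSet n → Set
IsMatching {n} G M =
  (∀ i j → M i j ≡ true → IsEdge G i j) ×
  (∀ a b c d → M a b ≡ true → M c d ≡ true →
     (a ≡ c ⊎' a ≡ d ⊎' b ≡ c ⊎' b ≡ d) → (a ≡ c × b ≡ d))
  where
  open import Data.Sum using () renaming (_⊎_ to _⊎'_)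

weightOf : ∀ {n} → Weight n → EdgeSet n → ℚ
weightOf {n} w M =
  foldr _+_ 0ℚ
    (concatMap (λ i → map (λ j → if M i j then w i j else 0ℚ) (allFin n))
               (allFin n))

IsMinWeight : ∀ {n} → SimpleGraph n → Weight n → ℚ → Set
IsMinWeight G w v =
  (∃ λ i → ∃ λ j → IsEdge G i j × w i j ≡ v) ×
  (∀ i j → IsEdge G i j → v Data.Rational.≤ w i j)
  where import Data.Rational

IsMaxMatchingWeight : ∀ {n} → SimpleGraph n → Weight n → ℚ → Set
IsMaxMatchingWeight G w v =
  (Σ _ λ M → IsMatching G M × weightOf w M ≡ v) ×
  (∀ M → IsMatching G M → weightOf w M Data.Rational.≤ v)
  where import Data.Rational

{-# OPTIONS --safe #-}
-- Put c = 1 + ε/t. Edgewise w ≤ w′ ≤ c·w, so OPT ≤ OPT′ and w′(M) ≤ c·w(M). Hence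
--   c·(1 − ε)·OPT ≤ (1 − θ)·OPT ≤ (1 − θ)·OPT′ ≤ w′(M) ≤ c·w(M),
-- where the first step holds because (1 − θ) − c·(1 − ε) = ε²/t ≥ 0. Dividing by c
-- gives the claim.
module Submission where

open import Defs hiding (sym)
open import Data.Nat using (ℕ; suc; NonZero; _∸_)
open import Data.Rational using (ℚ; _≤_; _<_; _+_; _-_; _*_; -_; 0ℚ; 1ℚ; _/_; toℚᵘ; positive; nonNegative)
open import Data.Integer using (+_)
open import Data.Rational.Properties
import Data.Rational.Unnormalised as ℚᵘ
import Data.Rational.Unnormalised.Properties as ℚᵘ
import Data.Integer as ℤ
import Data.Integer.Solver as ℤ-Solver
import Data.Rational.Solver as ℚ-Solver
open import Relation.Binary.PropositionalEquality using (_≡_; _≢_; refl; sym; cong; subst; module ≡-Reasoning)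
open import Data.Product using (_,_; proj₁)
open import Data.Bool using (true; false; if_then_else_)
open import Data.List using (List; map; allFin)
open import Data.Fin using (Fin)
open import Data.List.Relation.Binary.Pointwise as Pointwise using (Pointwise; foldr⁺; concat⁺; map⁺)
open import Relation.Nullary using (yes; no)

p≤p+q : ∀ p {q} → 0ℚ ≤ q → p ≤ p + q
p≤p+q p 0≤q = ≤-trans (≤-reflexive (sym (+-identityʳ p))) (+-monoʳ-≤ p 0≤q)

0≤p*q : ∀ {p q} → 0ℚ ≤ p → 0ℚ ≤ q → 0ℚ ≤ p * q
0≤p*q {p} {q} 0≤p 0≤q =
  nonNegative⁻¹ _ {{nonNeg*nonNeg⇒nonNeg p {{nonNegative 0≤p}} q {{nonNegative 0≤q}}}}

p≤q⇒0≤q-p : ∀ {p q} → p ≤ q → 0ℚ ≤ q - p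
p≤q⇒0≤q-p {p} {q} p≤q = subst (_≤ q - p) (+-inverseʳ p) (+-monoˡ-≤ (- p) p≤q)

1/[1+k]+k/[1+k]≡1 : ∀ k → (+ 1) / suc k + (+ k) / suc k ≡ 1ℚ
1/[1+k]+k/[1+k]≡1 k = toℚᵘ-injective (begin
  toℚᵘ ((+ 1) / suc k + (+ k) / suc k)
    ≈⟨ toℚᵘ-homo-+ ((+ 1) / suc k) ((+ k) / suc k) ⟩
  toℚᵘ ((+ 1) / suc k) ℚᵘ.+ toℚᵘ ((+ k) / suc k)
    ≈⟨ ℚᵘ.+-cong (toℚᵘ-fromℚᵘ (ℚᵘ.mkℚᵘ (+ 1) k)) (toℚᵘ-fromℚᵘ (ℚᵘ.mkℚᵘ (+ k) k)) ⟩
  ℚᵘ.mkℚᵘ (+ 1) k ℚᵘ.+ ℚᵘ.mkℚᵘ (+ k) k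
    ≈⟨ ℚᵘ.*≡* (cross-multiplied (+ k)) ⟩
  ℚᵘ.1ℚᵘ ∎)
  where
  open ℚᵘ.≃-Reasoning
  cross-multiplied : ∀ x → let d = + 1 ℤ.+ x in (+ 1 ℤ.* d ℤ.+ x ℤ.* d) ℤ.* + 1 ≡ + 1 ℤ.* (d ℤ.* d)
  cross-multiplied = solve 1 (λ x → (con (+ 1) :* (con (+ 1) :+ x) :+ x :* (con (+ 1) :+ x)) :* con (+ 1)
                                  := con (+ 1) :* ((con (+ 1) :+ x) :* (con (+ 1) :+ x))) refl
    where open ℤ-Solver.+-*-Solver

k/[1+k]≡1-1/[1+k] : ∀ k → (+ k) / suc k ≡ 1ℚ - (+ 1) / suc k
k/[1+k]≡1-1/[1+k] k = begin
  v           ≡⟨ solve 2 (λ u v → v := (u :+ v) :- u) refl u v ⟩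
  (u + v) - u ≡⟨ cong (_- u) (1/[1+k]+k/[1+k]≡1 k) ⟩
  1ℚ - u      ∎
  where
  open ≡-Reasoning
  open ℚ-Solver.+-*-Solver
  u v : ℚ
  u = (+ 1) / suc k
  v = (+ k) / suc k

scaling-loss : ∀ {ε u} → 0ℚ ≤ ε → 0ℚ ≤ u → (1ℚ + ε * u) * (1ℚ - ε) ≤ 1ℚ - (1ℚ - u) * ε
scaling-loss {ε} {u} 0≤ε 0≤u = ≤-trans (p≤p+q _ (0≤p*q (0≤p*q 0≤ε 0≤ε) 0≤u)) (≤-reflexive (sym identity))
  where
  open ℚ-Solver.+-*-Solver
  identity : 1ℚ - (1ℚ - u) * ε ≡ (1ℚ + ε * u) * (1ℚ - ε) + ε * ε * u
  identity = solve 2 (λ u e → con 1ℚ :- (con 1ℚ :- u) :* e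
                             := (con 1ℚ :+ e :* u) :* (con 1ℚ :- e) :+ e :* e :* u) refl u ε

raised-≥ : ∀ {x x′ v v′} → (x ≡ v → x′ ≡ v′) → (x ≢ v → x′ ≡ x) → v ≤ v′ → x ≤ x′
raised-≥ {x} {v = v} raised unchanged v≤v′ with x ≟ v
... | yes refl = ≤-trans v≤v′ (≤-reflexive (sym (raised refl)))
... | no x≢v = ≤-reflexive (sym (unchanged x≢v))

raised-≤-* : ∀ {x x′ v v′ c} → (x ≡ v → x′ ≡ v′) → (x ≢ v → x′ ≡ x) →
             v′ ≤ c * v → 1ℚ ≤ c → 0ℚ ≤ x → x′ ≤ c * x
raised-≤-* {x} {v = v} {c = c} raised unchanged v′≤cv 1≤c 0≤x with x ≟ v
... | yes refl = ≤-trans (≤-reflexive (raised refl)) v′≤cv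
... | no x≢v = begin
  _      ≡⟨ unchanged x≢v ⟩
  x      ≡⟨ sym (*-identityˡ x) ⟩
  1ℚ * x ≤⟨ *-monoʳ-≤-nonNeg x {{nonNegative 0≤x}} 1≤c ⟩
  c * x  ∎
  where open ≤-Reasoning

module _ (R : ℚ → ℚ → Set) (R-0 : R 0ℚ 0ℚ)
         (R-+ : ∀ {a b c d} → R a b → R c d → R (a + c) (b + d)) where

  weightOf-preserves : ∀ {n} (w w′ : Weight n) (M : EdgeSet n) →
                       (∀ i j → M i j ≡ true → R (w i j) (w′ i j)) → R (weightOf w M) (weightOf w′ M)
  weightOf-preserves {n} w w′ M R-on-M =
    foldr⁺ {_•_ = _+_} {_+_} R-+ {0ℚ} {0ℚ} R-0
      (concat⁺ (map⁺ (row w) (row w′) (Pointwise.refl R-row {allFin n})))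
    where
    entry : Weight n → Fin n → Fin n → ℚ
    entry v i j = if M i j then v i j else 0ℚ
    row : Weight n → Fin n → List ℚ
    row v i = map (entry v i) (allFin n)
    R-entry : ∀ {i j} → R (entry w i j) (entry w′ i j)
    R-entry {i} {j} with M i j in M∋ij
    ... | true = R-on-M i j M∋ij
    ... | false = R-0
    R-row : ∀ {i} → Pointwise R (row w i) (row w′ i)
    R-row {i} = map⁺ (entry w i) (entry w′ i) (Pointwise.refl R-entry)

weightOf-nonNeg : ∀ {n} (w : Weight n) (M : EdgeSet n) →
                  (∀ i j → M i j ≡ true → 0ℚ ≤ w i j) → 0ℚ ≤ weightOf w M
weightOf-nonNeg w M =
  weightOf-preserves (λ _ b → 0ℚ ≤ b) ≤-refl +-mono-≤ w w M

weightOf-mono-≤ : ∀ {n} (w w′ : Weight n) (M : EdgeSet n) →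
                  (∀ i j → M i j ≡ true → w i j ≤ w′ i j) → weightOf w M ≤ weightOf w′ M
weightOf-mono-≤ = weightOf-preserves _≤_ ≤-refl +-mono-≤

weightOf-≤-* : ∀ {n} c (w w′ : Weight n) (M : EdgeSet n) →
               (∀ i j → M i j ≡ true → w′ i j ≤ c * w i j) → weightOf w′ M ≤ c * weightOf w M
weightOf-≤-* c w w′ M =
  weightOf-preserves (λ a b → a ≤ c * b) (≤-reflexive (sym (*-zeroʳ c)))
    (λ {_} {b} {_} {d} p q → ≤-trans (+-mono-≤ p q) (≤-reflexive (sym (*-distribˡ-+ c b d))))
    w′ w M

module _ {n} (G : SimpleGraph n) where

  onMatching : ∀ {M} {P : _ → _ → Set} → IsMatching G M →
               (∀ i j → IsEdge G i j → P i j) → ∀ i j → M i j ≡ true → P i j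
  onMatching M-matching P-on-edges i j M∋ij = P-on-edges i j (proj₁ M-matching i j M∋ij)

  maxMatchingWeight-nonNeg : ∀ {w OPT} → (∀ i j → IsEdge G i j → 0ℚ ≤ w i j) →
                             IsMaxMatchingWeight G w OPT → 0ℚ ≤ OPT
  maxMatchingWeight-nonNeg {w} w≥0 ((M , M-matching , refl) , _) =
    weightOf-nonNeg w M (onMatching M-matching w≥0)

  maxMatchingWeight-mono-≤ : ∀ {w w′ OPT OPT′} → (∀ i j → IsEdge G i j → w i j ≤ w′ i j) →
                             IsMaxMatchingWeight G w OPT → IsMaxMatchingWeight G w′ OPT′ → OPT ≤ OPT′
  maxMatchingWeight-mono-≤ {w} {w′} w≤w′ ((M , M-matching , refl) , _) (_ , OPT′-max) =
    ≤-trans (weightOf-mono-≤ w w′ M (onMatching M-matching w≤w′)) (OPT′-max M M-matching)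

lemma1 : (t : ℕ) → .{{_ : NonZero t}} → (n : ℕ) → (G : SimpleGraph n) → (w : Weight n)
    → PositiveWeight G w
    → (ε : ℚ) → 0ℚ < ε → ε < 1ℚ
    → (w₁ : ℚ) → IsMinWeight G w w₁
    → (w₁' : ℚ) → w₁ ≤ w₁' → w₁' ≤ (1ℚ + ε * ((+ 1) / t)) * w₁
    → (w' : Weight n)
    → (∀ i j → IsEdge G i j → w i j ≡ w₁ → w' i j ≡ w₁')
    → (∀ i j → IsEdge G i j → w i j ≢ w₁ → w' i j ≡ w i j)
    → (OPT OPT' : ℚ) → IsMaxMatchingWeight G w OPT → IsMaxMatchingWeight G w' OPT'
    → (M : EdgeSet n) → IsMatching G M
    → (1ℚ - ((+ (t ∸ 1)) / t) * ε) * OPT' ≤ weightOf w' M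
    → (1ℚ - ε) * OPT ≤ weightOf w M
lemma1 (suc k) n G w w>0 ε 0<ε ε<1 w₁ _ w₁′ w₁≤w₁′ w₁′≤cw₁ w′ raised unchanged OPT OPT′ opt opt′
  M M-matching approx = *-cancelˡ-≤-pos c {{positive 0<c}} (begin
    c * ((1ℚ - ε) * OPT)  ≡⟨ sym (*-assoc c (1ℚ - ε) OPT) ⟩
    c * (1ℚ - ε) * OPT    ≤⟨ *-monoʳ-≤-nonNeg OPT {{nonNegative 0≤OPT}} (scaling-loss 0≤ε 0≤u) ⟩
    (1ℚ - θ) * OPT        ≤⟨ *-monoˡ-≤-nonNeg (1ℚ - θ) {{nonNegative 0≤1-θ}} OPT≤OPT′ ⟩
    (1ℚ - θ) * OPT′       ≡⟨ cong (λ r → (1ℚ - r * ε) * OPT′) (sym (k/[1+k]≡1-1/[1+k] k)) ⟩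
    (1ℚ - (+ k) / suc k * ε) * OPT′
                          ≤⟨ approx ⟩
    weightOf w′ M         ≤⟨ weightOf-≤-* c w w′ M (onMatching G M-matching w′≤cw) ⟩
    c * weightOf w M      ∎)
  where
  open ≤-Reasoning
  u c θ : ℚ
  u = (+ 1) / suc k
  c = 1ℚ + ε * u
  θ = (1ℚ - u) * ε

  0≤ε : 0ℚ ≤ ε
  0≤ε = <⇒≤ 0<ε
  0≤u : 0ℚ ≤ u
  0≤u = nonNegative⁻¹ u {{normalize-nonNeg 1 (suc k)}}
  1≤c : 1ℚ ≤ c
  1≤c = p≤p+q 1ℚ (0≤p*q 0≤ε 0≤u)
  0<c : 0ℚ < c
  0<c = <-≤-trans (positive⁻¹ 1ℚ) 1≤c
  0≤1-ε : 0ℚ ≤ 1ℚ - ε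
  0≤1-ε = p≤q⇒0≤q-p (<⇒≤ ε<1)
  0≤1-θ : 0ℚ ≤ 1ℚ - θ
  0≤1-θ = ≤-trans (0≤p*q (<⇒≤ 0<c) 0≤1-ε) (scaling-loss 0≤ε 0≤u)

  0≤w : ∀ i j → IsEdge G i j → 0ℚ ≤ w i j
  0≤w i j e = <⇒≤ (positive⁻¹ (w i j) {{w>0 i j e}})
  w≤w′ : ∀ i j → IsEdge G i j → w i j ≤ w′ i j
  w≤w′ i j e = raised-≥ (raised i j e) (unchanged i j e) w₁≤w₁′
  w′≤cw : ∀ i j → IsEdge G i j → w′ i j ≤ c * w i j
  w′≤cw i j e = raised-≤-* (raised i j e) (unchanged i j e) w₁′≤cw₁ 1≤c (0≤w i j e)

  0≤OPT : 0ℚ ≤ OPT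
  0≤OPT = maxMatchingWeight-nonNeg G 0≤w opt
  OPT≤OPT′ : OPT ≤ OPT′
  OPT≤OPT′ = maxMatchingWeight-mono-≤ G w≤w′ opt opt′
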